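{- Let $n=p_1p_2\cdots p_r$, where $r\geq 3$ and $p_1<p_2<\cdots<p_r$ are prime numbers, and let $3\leq s\leq r$. If $\deg(p_{s-1}p_s\cdots p_r)\geq\deg(p_sp_{s+1}\cdots p_r)$ in $\mathcal{P}(C_n)$, then $$\deg(p_{s-2}p_{s-1}\cdots p_r)>\deg(p_{s-1}p_s\cdots p_r).$$
   Context: For a finite group $G$, the power graph $\mathcal{P}(G)$ is the simple undirected graph with vertex set $G$ in which two distinct vertices are adjacent if one of them is an integral power of the other. $C_n$ denotes the cyclic group of order $n$, identified with $\mathbb{Z}_n=\{0,1,\ldots,n-1\}$; a positive divisor $d$ of $n$ is regarded as the vertex $d \bmod n$ (in particular $n$ is the vertex $0$). $\deg(a)$ denotes the degree of vertex $a$ in $\mathcal{P}(C_n)$. -}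

module Defs where

open import Data.Nat using (ℕ; zero; suc; _+_; _*_; _∸_; _≡ᵇ_)
open import Data.Nat.DivMod using (_%_)
open import Data.Bool using (Bool; not; _∧_; _∨_)
open import Data.List using (List; upTo; filterᵇ; length)
open import Data.Bool.ListAction using (any)

prodFrom : (ℕ → ℕ) → ℕ → ℕ → ℕ
prodFrom p i zero    = 1
prodFrom p i (suc k) = p i * prodFrom p (suc i) k

-- ∏_{j=i}^{r} p j   (empty product = 1 when i > r)
prodRange : (ℕ → ℕ) → ℕ → ℕ → ℕ
prodRange p i r = prodFrom p i (suc r ∸ i)

-- C_n is identified with Z_n = {0,…,n-1} (additive).  For a, b ∈ Z_n,
-- "a is an integral power of b" means a = k·b (mod n) for some integer k;
-- since k·b depends only on k mod n, it suffices to let k range over 0,…,n-1.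
isPowerOf : ℕ → ℕ → ℕ → Bool
isPowerOf zero    a b = Data.Bool.false
isPowerOf (suc m) a b = any (λ k → ((k * b) % suc m) ≡ᵇ a) (upTo (suc m))

adjacent : ℕ → ℕ → ℕ → Bool
adjacent n a b = not (a ≡ᵇ b) ∧ (isPowerOf n a b ∨ isPowerOf n b a)

-- deg(a) in P(C_n); the natural number a is regarded as the vertex a mod n
deg : ℕ → ℕ → ℕ
deg zero    a = 0
deg (suc m) a = length (filterᵇ (λ b → adjacent (suc m) (a % suc m) b) (upTo (suc m)))

module Submission where

-- Write s = t + 3 and split n = p₁⋯p_r as n = D·q·P·E with D = p₁⋯p_t, q = p_{t+1} = p_{s-2},
-- P = p_{t+2} = p_{s-1} and E = p_s⋯p_r; the three vertices of the theorem are q·P·E, P·E and E.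
--
-- The key fact is a degree formula (deg-formula): if n = d·e with gcd(d, e) = 1, then
--     deg(e) + 1 = e·φ(d) + (d − φ(d))   in P(C_n).
-- Indeed b ∈ Z_n is a multiple of e iff e ∣ b, and e is a multiple of b iff gcd(b, n) ∣ e, i.e.
-- iff gcd(b, d) = 1; there are e·φ(d) residues of the second kind and, by Chinese remainder
-- counting, d − φ(d) residues of the first kind not of the second.
-- Applied with d = D, D·q, D·q·P, and with φ(D·q) = (q − 1)φ(D), φ(D·q·P) = (P − 1)(q − 1)φ(D),
-- the hypothesis deg(E) ≤ deg(P·E) and the goal deg(P·E) < deg(q·P·E) become polynomial
-- inequalities in q, P, E, φ(D), D − φ(D); the first implies the second because q < P.

open import Defs
open import Data.Nat
  using (ℕ; zero; suc; _+_; _*_; _∸_; _≡ᵇ_; _≤_; _<_; _≥_; _>_; s≤s; z≤n; NonZero; >-nonZero; nonTrivial⇒n>1)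
open import Data.Nat.Properties
open import Algebra.Properties.CommutativeSemigroup +-commutativeSemigroup
  using () renaming (interchange to +-interchange)
open import Data.Nat.DivMod
  using (_%_; _/_; [m+kn]%n≡m%n; m<n⇒m%n≡m; m%n<n; %-distribˡ-*; m%n%n≡m%n; m≡m%n+[m/n]*n)
open import Data.Nat.Divisibility
open import Data.Nat.GCD
open import Data.Nat.Coprimality
  using (Coprime; coprime?; coprime-divisor; coprime-Bézout; coprime-+; 1-coprimeTo; prime⇒coprime)
import Data.Nat.Coprimality as Coprimality
open import Data.Nat.Primality using (Prime; prime⇒irreducible; prime⇒nonTrivial; prime⇒nonZero)
open import Data.Bool using (Bool; true; false; not; _∧_; _∨_; T)
open import Data.Bool.Properties using (∧-comm; ∧-zeroʳ; ∧-identityʳ)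
open import Data.List using (upTo; applyUpTo; filterᵇ; length)
open import Data.List.Membership.Propositional using (find; lose)
open import Data.List.Membership.Propositional.Properties using (∈-upTo⁺)
open import Data.List.Relation.Unary.Any.Properties using (any⁺; any⁻)
open import Data.Product using (∃-syntax; _×_; _,_)
open import Data.Sum using (inj₁; inj₂)
open import Data.Empty using (⊥-elim)
open import Function using (_∘_; const)
open import Relation.Binary.PropositionalEquality
open import Relation.Nullary using (yes; no)
open import Relation.Nullary.Decidable using (⌊_⌋; toWitness; fromWitness)
open import Data.Nat.Tactic.RingSolver using (solve-∀)

sum< : (ℕ → ℕ) → ℕ → ℕ
sum< f zero    = 0
sum< f (suc n) = f 0 + sum< (f ∘ suc) n

sum<-ext : ∀ n (f g : ℕ → ℕ) → (∀ i → i < n → f i ≡ g i) → sum< f n ≡ sum< g n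
sum<-ext zero    f g f≗g = refl
sum<-ext (suc n) f g f≗g =
  cong₂ _+_ (f≗g 0 (s≤s z≤n)) (sum<-ext n (f ∘ suc) (g ∘ suc) (λ i i<n → f≗g (suc i) (s≤s i<n)))

sum<-+ : ∀ n (f g : ℕ → ℕ) → sum< (λ i → f i + g i) n ≡ sum< f n + sum< g n
sum<-+ zero    f g = refl
sum<-+ (suc n) f g = begin
    (f 0 + g 0) + sum< (λ i → f (suc i) + g (suc i)) n
  ≡⟨ cong ((f 0 + g 0) +_) (sum<-+ n (f ∘ suc) (g ∘ suc)) ⟩
    (f 0 + g 0) + (sum< (f ∘ suc) n + sum< (g ∘ suc) n)
  ≡⟨ +-interchange (f 0) (g 0) _ _ ⟩
    (f 0 + sum< (f ∘ suc) n) + (g 0 + sum< (g ∘ suc) n) ∎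
  where open ≡-Reasoning

sum<-* : ∀ n c (f : ℕ → ℕ) → sum< (λ i → c * f i) n ≡ c * sum< f n
sum<-* zero    c f = sym (*-zeroʳ c)
sum<-* (suc n) c f =
  trans (cong (c * f 0 +_) (sum<-* n c (f ∘ suc))) (sym (*-distribˡ-+ c (f 0) _))

sum<-const : ∀ n c → sum< (const c) n ≡ n * c
sum<-const zero    c = refl
sum<-const (suc n) c = cong (c +_) (sum<-const n c)

sum<-++ : ∀ a b (f : ℕ → ℕ) → sum< f (a + b) ≡ sum< f a + sum< (λ i → f (a + i)) b
sum<-++ zero    b f = refl
sum<-++ (suc a) b f =
  trans (cong (f 0 +_) (sum<-++ a b (f ∘ suc))) (sym (+-assoc (f 0) _ _))

sum<-blocks : ∀ e d (f : ℕ → ℕ) →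
  sum< f (e * d) ≡ sum< (λ i → sum< (λ j → f (i * d + j)) d) e
sum<-blocks zero    d f = refl
sum<-blocks (suc e) d f = begin
    sum< f (d + e * d)
  ≡⟨ sum<-++ d (e * d) f ⟩
    sum< f d + sum< (λ k → f (d + k)) (e * d)
  ≡⟨ cong (sum< f d +_) (sum<-blocks e d (λ k → f (d + k))) ⟩
    sum< f d + sum< (λ i → sum< (λ j → f (d + (i * d + j))) d) e
  ≡⟨ cong (sum< f d +_) (sum<-ext e _ _ λ i _ → sum<-ext d _ _ λ j _ →
       cong f (sym (+-assoc d (i * d) j))) ⟩
    sum< f d + sum< (λ i → sum< (λ j → f (d + i * d + j)) d) e ∎
  where open ≡-Reasoning

sum<-swap : ∀ e d (f : ℕ → ℕ → ℕ) →
  sum< (λ i → sum< (f i) d) e ≡ sum< (λ j → sum< (λ i → f i j) e) d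
sum<-swap zero    d f = sym (trans (sum<-const d 0) (*-zeroʳ d))
sum<-swap (suc e) d f =
  trans (cong (sum< (f 0) d +_) (sum<-swap e d (f ∘ suc)))
        (sym (sum<-+ d (f 0) (λ j → sum< (λ i → f (suc i) j) e)))

periodic-shift : ∀ {A : Set} (f : ℕ → A) d → (∀ i → f (d + i) ≡ f i) → ∀ k j → f (k * d + j) ≡ f j
periodic-shift f d per zero    j = refl
periodic-shift f d per (suc k) j =
  trans (cong f (+-assoc d (k * d) j)) (trans (per (k * d + j)) (periodic-shift f d per k j))

sum<-periodic : ∀ e d (f : ℕ → ℕ) → (∀ i → f (d + i) ≡ f i) → sum< f (e * d) ≡ e * sum< f d
sum<-periodic e d f per = begin
    sum< f (e * d)
  ≡⟨ sum<-blocks e d f ⟩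
    sum< (λ i → sum< (λ j → f (i * d + j)) d) e
  ≡⟨ sum<-ext e _ _ (λ i _ → sum<-ext d _ _ (λ j _ → periodic-shift f d per i j)) ⟩
    sum< (const (sum< f d)) e
  ≡⟨ sum<-const e _ ⟩
    e * sum< f d ∎
  where open ≡-Reasoning

𝟙 : Bool → ℕ
𝟙 true  = 1
𝟙 false = 0

count : (ℕ → Bool) → ℕ → ℕ
count P = sum< (𝟙 ∘ P)

𝟙-∧ : ∀ x y → 𝟙 (x ∧ y) ≡ 𝟙 x * 𝟙 y
𝟙-∧ true  y = sym (+-identityʳ (𝟙 y))
𝟙-∧ false y = refl

length-filter : ∀ (P : ℕ → Bool) (f : ℕ → ℕ) n →
  length (filterᵇ P (applyUpTo f n)) ≡ count (P ∘ f) n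
length-filter P f zero = refl
length-filter P f (suc n) with P (f 0)
... | true  = cong suc (length-filter P (f ∘ suc) n)
... | false = length-filter P (f ∘ suc) n

count-ext : ∀ n (P Q : ℕ → Bool) → (∀ i → i < n → P i ≡ Q i) → count P n ≡ count Q n
count-ext n P Q P≗Q = sum<-ext n _ _ (λ i i<n → cong 𝟙 (P≗Q i i<n))

count-split : ∀ n (P X : ℕ → Bool) →
  count P n ≡ count (λ i → P i ∧ X i) n + count (λ i → P i ∧ not (X i)) n
count-split n P X = trans (sum<-ext n _ _ (λ i _ → 𝟙-split (P i) (X i))) (sum<-+ n _ _)
  where
  𝟙-split : ∀ x y → 𝟙 x ≡ 𝟙 (x ∧ y) + 𝟙 (x ∧ not y)
  𝟙-split true  true  = refl
  𝟙-split true  false = refl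
  𝟙-split false y     = refl

count-true : ∀ n → count (const true) n ≡ n
count-true n = trans (sum<-const n 1) (*-identityʳ n)

count-≡ᵇ : ∀ n k → k < n → count (_≡ᵇ k) n ≡ 1
count-≡ᵇ (suc n) zero    _         = cong suc (trans (sum<-const n 0) (*-zeroʳ n))
count-≡ᵇ (suc n) (suc k) (s≤s k<n) = count-≡ᵇ n k k<n

count-pos : ∀ n (P : ℕ → Bool) k → k < n → T (P k) → 1 ≤ count P n
count-pos (suc n) P zero    _         Pk with P 0
... | true = s≤s z≤n
count-pos (suc n) P (suc k) (s≤s k<n) Pk =
  ≤-trans (count-pos n (P ∘ suc) k k<n Pk) (m≤n+m _ (𝟙 (P 0)))

T-ext : ∀ {x y : Bool} → (T x → T y) → (T y → T x) → x ≡ y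
T-ext {true}  {true}  _   _   = refl
T-ext {true}  {false} x⇒y _   = ⊥-elim (x⇒y _)
T-ext {false} {true}  _   y⇒x = ⊥-elim (y⇒x _)
T-ext {false} {false} _   _   = refl

mod-cancel : ∀ m K M N a → K + M * suc m ≡ N * suc m + a → K % suc m ≡ a % suc m
mod-cancel m K M N a eq = begin
    K % suc m                ≡⟨ sym ([m+kn]%n≡m%n K M (suc m)) ⟩
    (K + M * suc m) % suc m  ≡⟨ cong (_% suc m) (trans eq (+-comm (N * suc m) a)) ⟩
    (a + N * suc m) % suc m  ≡⟨ [m+kn]%n≡m%n a N (suc m) ⟩
    a % suc m ∎
  where open ≡-Reasoning

gcd-multiple : ∀ b m → ∃[ K ] ∃[ M ] ∃[ N ] K * b + M * suc m ≡ N * suc m + gcd b (suc m)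
gcd-multiple b m with Bézout.identity (gcd-GCD b (suc m))
... | Bézout.+- x y g+yn≡xb = x , 0 , y , trans (+-identityʳ (x * b)) (trans (sym g+yn≡xb) (+-comm _ (y * suc m)))
... | Bézout.-+ x y g+xb≡yn = m * x , g , m * y , (begin
      m * x * b + g * suc m    ≡⟨ rearrange m x b g ⟩
      m * (g + x * b) + g      ≡⟨ cong (λ z → m * z + g) g+xb≡yn ⟩
      m * (y * suc m) + g      ≡⟨ cong (_+ g) (sym (*-assoc m y (suc m))) ⟩
      m * y * suc m + g ∎)
  where
  open ≡-Reasoning
  g : ℕ
  g = gcd b (suc m)
  rearrange : ∀ m x b g → m * x * b + g * suc m ≡ m * (g + x * b) + g
  rearrange = solve-∀

-- The witness search in isPowerOf only looks at k < n; reducing k modulo n is harmless.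
reduce-multiplier : ∀ m K b → ((K % suc m) * b) % suc m ≡ (K * b) % suc m
reduce-multiplier m K b = begin
    ((K % n) * b) % n            ≡⟨ %-distribˡ-* (K % n) b n ⟩
    ((K % n % n) * (b % n)) % n  ≡⟨ cong (λ z → (z * (b % n)) % n) (m%n%n≡m%n K n) ⟩
    ((K % n) * (b % n)) % n      ≡⟨ sym (%-distribˡ-* K b n) ⟩
    (K * b) % n ∎
  where
  open ≡-Reasoning
  n : ℕ
  n = suc m

isPowerOf⇒∣ : ∀ m a b → T (isPowerOf (suc m) a b) → gcd b (suc m) ∣ a
isPowerOf⇒∣ m a b t with find (any⁻ _ (upTo (suc m)) t)
... | k , _ , kb≡a = subst (gcd b (suc m) ∣_) (≡ᵇ⇒≡ _ _ kb≡a)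
  (%-presˡ-∣ (∣n⇒∣m*n k (gcd[m,n]∣m b (suc m))) (gcd[m,n]∣n b (suc m)))

∣⇒isPowerOf : ∀ m a b → a < suc m → gcd b (suc m) ∣ a → T (isPowerOf (suc m) a b)
∣⇒isPowerOf m a b a<n (divides c a≡cg) with gcd-multiple b m
... | K , M , N , Kb+Mn≡Nn+g = any⁺ _ (lose (∈-upTo⁺ (m%n<n (c * K) n)) (≡⇒≡ᵇ _ _ cKb≡a))
  where
  open ≡-Reasoning
  n : ℕ
  n = suc m
  -- Multiplying Bézout's congruence by c turns gcd(b, n) into a.
  scaled : c * K * b + c * M * n ≡ c * N * n + a
  scaled = begin
      c * K * b + c * M * n          ≡⟨ distribute c K b M n ⟩
      c * (K * b + M * n)            ≡⟨ cong (c *_) Kb+Mn≡Nn+g ⟩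
      c * (N * n + gcd b n)          ≡⟨ *-distribˡ-+ c (N * n) _ ⟩
      c * (N * n) + c * gcd b n      ≡⟨ cong₂ _+_ (sym (*-assoc c N n)) (sym a≡cg) ⟩
      c * N * n + a ∎
    where
    distribute : ∀ c K b M n → c * K * b + c * M * n ≡ c * (K * b + M * n)
    distribute = solve-∀
  cKb≡a : ((c * K % n) * b) % n ≡ a
  cKb≡a = begin
      ((c * K % n) * b) % n  ≡⟨ reduce-multiplier m (c * K) b ⟩
      (c * K * b) % n        ≡⟨ mod-cancel m _ (c * M) (c * N) a scaled ⟩
      a % n                  ≡⟨ m<n⇒m%n≡m a<n ⟩
      a ∎

-- Coprime is an implicit-function type, so its reflection into Bool needs explicit η-expansion.
coprime⇒T : ∀ {b d} → Coprime b d → T ⌊ coprime? b d ⌋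
coprime⇒T {b} {d} b⊥d = fromWitness {a? = coprime? b d} (λ {i} → b⊥d {i})

T⇒coprime : ∀ {b d} → T ⌊ coprime? b d ⌋ → Coprime b d
T⇒coprime {b} {d} t {i} = toWitness {a? = coprime? b d} t {i}

module UnitaryDivisor (m d e : ℕ) (n≡de : suc m ≡ d * e) (d⊥e : Coprime d e) where

  private
    n : ℕ
    n = suc m

  v : ℕ
  v = e % n

  v<n : v < n
  v<n = m%n<n e n

  d∣n : d ∣ n
  d∣n = subst (d ∣_) (sym n≡de) (m∣m*n e)

  e∣n : e ∣ n
  e∣n = subst (e ∣_) (sym n≡de) (n∣m*n d)

  e∣v : e ∣ v
  e∣v = %-presˡ-∣ ∣-refl e∣n

  gcd∣e⇒coprime : ∀ b → gcd b n ∣ e → Coprime b d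
  gcd∣e⇒coprime b g∣e (i∣b , i∣d) = d⊥e (i∣d , ∣-trans (gcd-greatest i∣b (∣-trans i∣d d∣n)) g∣e)

  coprime⇒gcd∣e : ∀ b → Coprime b d → gcd b n ∣ e
  coprime⇒gcd∣e b b⊥d = coprime-divisor g⊥d (subst (gcd b n ∣_) n≡de (gcd[m,n]∣n b n))
    where
    g⊥d : Coprime (gcd b n) d
    g⊥d (i∣g , i∣d) = b⊥d (∣-trans i∣g (gcd[m,n]∣m b n) , i∣d)

  gcd[v,n]≡e : gcd v n ≡ e
  gcd[v,n]≡e = GCD.unique (gcd-GCD v n) (GCD.is (e∣v , e∣n) (λ (i∣v , i∣n) → ∣n∣m%n⇒∣m i∣n i∣v))

  v-multiple-of : ∀ b → isPowerOf n v b ≡ ⌊ coprime? b d ⌋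
  v-multiple-of b = T-ext
    (λ t → coprime⇒T (gcd∣e⇒coprime b (∣n∣m%n⇒∣m (gcd[m,n]∣n b n) (isPowerOf⇒∣ m v b t))))
    (λ t → ∣⇒isPowerOf m v b v<n (%-presˡ-∣ (coprime⇒gcd∣e b (T⇒coprime t)) (gcd[m,n]∣n b n)))

  multiple-of-v : ∀ b → b < n → isPowerOf n b v ≡ ⌊ e ∣? b ⌋
  multiple-of-v b b<n = T-ext
    (λ t → fromWitness (subst (_∣ b) gcd[v,n]≡e (isPowerOf⇒∣ m b v t)))
    (λ t → ∣⇒isPowerOf m b v b<n (subst (_∣ b) (sym gcd[v,n]≡e) (toWitness t)))

  adjacent-v : ∀ b → b < n → adjacent n v b ≡ not (v ≡ᵇ b) ∧ (⌊ coprime? b d ⌋ ∨ ⌊ e ∣? b ⌋)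
  adjacent-v b b<n = cong (λ z → not (v ≡ᵇ b) ∧ z) (cong₂ _∨_ (v-multiple-of b) (multiple-of-v b b<n))

solution-mod : ∀ d e j i .{{_ : NonZero e}} → e ∣ i * d + j → e ∣ (i % e) * d + j
solution-mod d e j i e∣idj = ∣m+n∣m⇒∣n (subst (e ∣_) split e∣idj) (n∣m*n (i / e * d))
  where
  split : i * d + j ≡ i / e * d * e + ((i % e) * d + j)
  split = begin
      i * d + j                          ≡⟨ cong (λ z → z * d + j) (m≡m%n+[m/n]*n i e) ⟩
      (i % e + i / e * e) * d + j        ≡⟨ rearrange (i % e) (i / e) e d j ⟩
      i / e * d * e + ((i % e) * d + j) ∎
    where
    open ≡-Reasoning
    rearrange : ∀ r q e d j → (r + q * e) * d + j ≡ q * d * e + (r * d + j)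
    rearrange = solve-∀

solution-exists : ∀ d e j .{{_ : NonZero e}} → Coprime d e → ∃[ i ] i < e × e ∣ i * d + j
solution-exists d e@(suc e') j d⊥e with coprime-Bézout d⊥e
... | Bézout.+- x y 1+ye≡xd = _ , m%n<n (e' * j * x) e , solution-mod d e j (e' * j * x) (divides (j + e' * j * y) (begin
      e' * j * x * d + j          ≡⟨ cong (_+ j) (*-assoc (e' * j) x d) ⟩
      e' * j * (x * d) + j        ≡⟨ cong (λ z → e' * j * z + j) (sym 1+ye≡xd) ⟩
      e' * j * (1 + y * e) + j    ≡⟨ rearrange e' j y ⟩
      (j + e' * j * y) * e ∎))
  where
  open ≡-Reasoning
  rearrange : ∀ e' j y → e' * j * (1 + y * suc e') + j ≡ (j + e' * j * y) * suc e'
  rearrange = solve-∀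
... | Bézout.-+ x y 1+xd≡ye = _ , m%n<n (j * x) e , solution-mod d e j (j * x) (divides (j * y) (begin
      j * x * d + j          ≡⟨ rearrange j x d ⟩
      j * (1 + x * d)        ≡⟨ cong (j *_) 1+xd≡ye ⟩
      j * (y * e)            ≡⟨ sym (*-assoc j y e) ⟩
      j * y * e ∎))
  where
  open ≡-Reasoning
  rearrange : ∀ j x d → j * x * d + j ≡ j * (1 + x * d)
  rearrange = solve-∀

solution-unique≤ : ∀ d e j i₁ i₂ .{{_ : NonZero e}} → Coprime d e → i₁ ≤ i₂ → i₂ < e →
                   e ∣ i₁ * d + j → e ∣ i₂ * d + j → i₁ ≡ i₂
solution-unique≤ d e j i₁ i₂ d⊥e i₁≤i₂ i₂<e e∣i₁ e∣i₂ with m≤n⇒∃[o]m+o≡n i₁≤i₂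
... | t , refl = sym (trans (cong (i₁ +_) t≡0) (+-identityʳ i₁))
  where
  rearrange : ∀ i t d j → (i + t) * d + j ≡ (i * d + j) + t * d
  rearrange = solve-∀
  e∣td : e ∣ t * d
  e∣td = ∣m+n∣m⇒∣n (subst (e ∣_) (rearrange i₁ t d j) e∣i₂) e∣i₁
  e∣t : e ∣ t
  e∣t = coprime-divisor (Coprimality.sym d⊥e) (subst (e ∣_) (*-comm t d) e∣td)
  t≡0 : t ≡ 0
  t≡0 = trans (sym (m<n⇒m%n≡m (≤-<-trans (m≤n+m t i₁) i₂<e))) (n∣m⇒m%n≡0 t e e∣t)

solution-unique : ∀ d e j i₁ i₂ .{{_ : NonZero e}} → Coprime d e → i₁ < e → i₂ < e →
                  e ∣ i₁ * d + j → e ∣ i₂ * d + j → i₁ ≡ i₂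
solution-unique d e j i₁ i₂ d⊥e i₁<e i₂<e e∣i₁ e∣i₂ with ≤-total i₁ i₂
... | inj₁ i₁≤i₂ = solution-unique≤ d e j i₁ i₂ d⊥e i₁≤i₂ i₂<e e∣i₁ e∣i₂
... | inj₂ i₂≤i₁ = sym (solution-unique≤ d e j i₂ i₁ d⊥e i₂≤i₁ i₁<e e∣i₂ e∣i₁)

count-solutions : ∀ d e j .{{_ : NonZero e}} → Coprime d e → count (λ i → ⌊ e ∣? i * d + j ⌋) e ≡ 1
count-solutions d e j d⊥e with solution-exists d e j d⊥e
... | i₀ , i₀<e , e∣i₀ = trans (count-ext e _ (_≡ᵇ i₀) is-i₀) (count-≡ᵇ e i₀ i₀<e)
  where
  is-i₀ : ∀ i → i < e → ⌊ e ∣? i * d + j ⌋ ≡ (i ≡ᵇ i₀)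
  is-i₀ i i<e = T-ext
    (λ t → ≡⇒≡ᵇ i i₀ (solution-unique d e j i i₀ d⊥e i<e i₀<e (toWitness t) e∣i₀))
    (λ t → fromWitness (subst (λ z → e ∣ z * d + j) (sym (≡ᵇ⇒≡ i i₀ t)) e∣i₀))

count-multiples : ∀ d e (A : ℕ → Bool) .{{_ : NonZero e}} → Coprime d e → (∀ i → A (d + i) ≡ A i) →
                  count (λ b → A b ∧ ⌊ e ∣? b ⌋) (e * d) ≡ count A d
count-multiples d e A d⊥e periodic = begin
    count (λ b → A b ∧ ⌊ e ∣? b ⌋) (e * d)
  ≡⟨ sum<-blocks e d _ ⟩
    sum< (λ i → sum< (λ j → f i j) d) e
  ≡⟨ sum<-swap e d f ⟩
    sum< (λ j → sum< (λ i → f i j) e) d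
  ≡⟨ sum<-ext d _ (𝟙 ∘ A) column ⟩
    count A d ∎
  where
  open ≡-Reasoning
  f : ℕ → ℕ → ℕ
  f i j = 𝟙 (A (i * d + j) ∧ ⌊ e ∣? i * d + j ⌋)
  column : ∀ j → j < d → sum< (λ i → f i j) e ≡ 𝟙 (A j)
  column j _ = begin
      sum< (λ i → f i j) e
    ≡⟨ sum<-ext e _ _ (λ i _ → trans (cong (λ z → 𝟙 (z ∧ _)) (periodic-shift A d periodic i j))
                                     (𝟙-∧ (A j) _)) ⟩
      sum< (λ i → 𝟙 (A j) * 𝟙 ⌊ e ∣? i * d + j ⌋) e
    ≡⟨ sum<-* e (𝟙 (A j)) _ ⟩
      𝟙 (A j) * count (λ i → ⌊ e ∣? i * d + j ⌋) e
    ≡⟨ cong (𝟙 (A j) *_) (count-solutions d e j d⊥e) ⟩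
      𝟙 (A j) * 1
    ≡⟨ *-identityʳ _ ⟩
      𝟙 (A j) ∎

≡ᵇ-sym : ∀ a b → (a ≡ᵇ b) ≡ (b ≡ᵇ a)
≡ᵇ-sym zero    zero    = refl
≡ᵇ-sym zero    (suc b) = refl
≡ᵇ-sym (suc a) zero    = refl
≡ᵇ-sym (suc a) (suc b) = ≡ᵇ-sym a b

coprimeTo : ℕ → ℕ → Bool
coprimeTo d j = ⌊ coprime? j d ⌋

φ : ℕ → ℕ
φ d = count (coprimeTo d) d

φᶜ : ℕ → ℕ
φᶜ d = count (not ∘ coprimeTo d) d

φ+φᶜ : ∀ d → φ d + φᶜ d ≡ d
φ+φᶜ d = trans (sym (count-split d (const true) (coprimeTo d))) (count-true d)

φ-pos : ∀ d → 1 ≤ d → 1 ≤ φ d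
φ-pos (suc d) _ = count-pos (suc d) (coprimeTo (suc d)) d ≤-refl (coprime⇒T d⊥1+d)
  where
  d⊥1+d : Coprime d (suc d)
  d⊥1+d = subst (Coprime d) (+-comm d 1) (Coprimality.sym (coprime-+ (1-coprimeTo d)))

coprimeTo-periodic : ∀ d i → coprimeTo d (d + i) ≡ coprimeTo d i
coprimeTo-periodic d i = T-ext
  (λ t → coprime⇒T (λ (j∣i , j∣d) → T⇒coprime t (∣m∣n⇒∣m+n j∣d j∣i , j∣d)))
  (λ t → coprime⇒T (λ (j∣d+i , j∣d) → T⇒coprime t (∣m+n∣m⇒∣n j∣d+i j∣d , j∣d)))

count-coprimeTo : ∀ e d → count (coprimeTo d) (e * d) ≡ e * φ d
count-coprimeTo e d = sum<-periodic e d _ (cong 𝟙 ∘ coprimeTo-periodic d)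

-- If n = d·e with gcd(d, e) = 1, the closed neighbourhood of the vertex e in P(C_n)
-- is { b ∣ gcd(b, d) = 1 } ∪ { b ∣ e ∣ b }; the first set has e·φ d elements and the part of the
-- second outside the first has φᶜ d elements (Chinese remainder counting).
module _ (d e : ℕ) where

  unitaryNeighbour : ℕ → Bool
  unitaryNeighbour b = coprimeTo d b ∨ ⌊ e ∣? b ⌋

  count-unitaryNeighbour : .{{_ : NonZero e}} → Coprime d e →
    count unitaryNeighbour (e * d) ≡ e * φ d + φᶜ d
  count-unitaryNeighbour d⊥e = begin
      count R (e * d)
    ≡⟨ count-split (e * d) R (coprimeTo d) ⟩
      count (λ b → R b ∧ coprimeTo d b) (e * d) + count (λ b → R b ∧ not (coprimeTo d b)) (e * d)
    ≡⟨ cong₂ _+_ (count-ext (e * d) _ _ (λ b _ → absorb (coprimeTo d b) _))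
                 (count-ext (e * d) _ _ (λ b _ → restrict (coprimeTo d b) _)) ⟩
      count (coprimeTo d) (e * d) + count (λ b → not (coprimeTo d b) ∧ ⌊ e ∣? b ⌋) (e * d)
    ≡⟨ cong₂ _+_ (count-coprimeTo e d)
                 (count-multiples d e (not ∘ coprimeTo d) d⊥e (cong not ∘ coprimeTo-periodic d)) ⟩
      e * φ d + φᶜ d ∎
    where
    open ≡-Reasoning
    R : ℕ → Bool
    R = unitaryNeighbour
    absorb : ∀ c x → (c ∨ x) ∧ c ≡ c
    absorb true  x = refl
    absorb false x = ∧-zeroʳ x
    restrict : ∀ c x → (c ∨ x) ∧ not c ≡ not c ∧ x
    restrict true  x = refl
    restrict false x = ∧-identityʳ x

  -- The vertex v itself satisfies unitaryNeighbour; the remaining ones are its neighbours.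
  closed-neighbourhood : ∀ m (n≡de : suc m ≡ d * e) (d⊥e : Coprime d e) →
    deg (suc m) e + 1 ≡ count unitaryNeighbour (suc m)
  closed-neighbourhood m n≡de d⊥e = begin
      deg n e + 1
    ≡⟨ cong (_+ 1) (trans (length-filter (adjacent n v) (λ i → i) n) (count-ext n _ _ adjacent-v)) ⟩
      count (λ b → not (v ≡ᵇ b) ∧ R b) n + 1
    ≡⟨ +-comm _ 1 ⟩
      1 + count (λ b → not (v ≡ᵇ b) ∧ R b) n
    ≡⟨ cong₂ _+_ (sym (trans (count-ext n _ _ (λ b _ → only-v b)) (count-≡ᵇ n v v<n)))
                 (count-ext n _ _ (λ b _ → ∧-comm (not (v ≡ᵇ b)) (R b))) ⟩
      count (λ b → R b ∧ (v ≡ᵇ b)) n + count (λ b → R b ∧ not (v ≡ᵇ b)) n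
    ≡⟨ sym (count-split n R (v ≡ᵇ_)) ⟩
      count R n ∎
    where
    open ≡-Reasoning
    open UnitaryDivisor m d e n≡de d⊥e
    n : ℕ
    n = suc m
    R : ℕ → Bool
    R = unitaryNeighbour
    Rv : R v ≡ true
    Rv with coprimeTo d v
    ... | true  = refl
    ... | false = T-ext _ (λ _ → fromWitness e∣v)
    only-v : ∀ b → (R b ∧ (v ≡ᵇ b)) ≡ (b ≡ᵇ v)
    only-v b with v ≡ᵇ b in v≟b
    ... | false = trans (∧-zeroʳ (R b)) (trans (sym v≟b) (≡ᵇ-sym v b))
    ... | true with ≡ᵇ⇒≡ v b (subst T (sym v≟b) _)
    ...   | refl = trans (∧-identityʳ (R v)) (trans Rv (sym v≟b))

deg-formula : ∀ d e → 1 ≤ d → 1 ≤ e → Coprime d e → deg (d * e) e + 1 ≡ e * φ d + φᶜ d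
deg-formula (suc d) (suc e) _ _ d⊥e =
  trans (closed-neighbourhood (suc d) (suc e) _ refl d⊥e)
        (trans (cong (count (unitaryNeighbour (suc d) (suc e))) (*-comm (suc d) (suc e)))
               (count-unitaryNeighbour (suc d) (suc e) d⊥e))

coprimeTo-*prime : ∀ D q → Prime q → ∀ b → coprimeTo (D * q) b ≡ (coprimeTo D b ∧ not ⌊ q ∣? b ⌋)
coprimeTo-*prime D q q-prime b = T-ext to from
  where
  q≢1 : q ≢ 1
  q≢1 refl with nonTrivial⇒n>1 1 {{prime⇒nonTrivial q-prime}}
  ... | s≤s ()
  to : T (coprimeTo (D * q) b) → T (coprimeTo D b ∧ not ⌊ q ∣? b ⌋)
  to t with coprime? b D | q ∣? b
  ... | yes _   | no _    = _
  ... | no ¬b⊥D | _       = ¬b⊥D (λ (i∣b , i∣D) → T⇒coprime t (i∣b , ∣m⇒∣m*n q i∣D))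
  ... | yes _   | yes q∣b = q≢1 (T⇒coprime t (q∣b , n∣m*n D))
  from : T (coprimeTo D b ∧ not ⌊ q ∣? b ⌋) → T (coprimeTo (D * q) b)
  from t with coprime? b D | q ∣? b
  ... | yes b⊥D | no q∤b = coprime⇒T b⊥Dq
    where
    b⊥Dq : Coprime b (D * q)
    b⊥Dq {i} (i∣b , i∣Dq) = b⊥D (i∣b , coprime-divisor i⊥q (subst (i ∣_) (*-comm D q) i∣Dq))
      where
      i⊥q : Coprime i q
      i⊥q (j∣i , j∣q) with prime⇒irreducible q-prime j∣q
      ... | inj₁ j≡1 = j≡1
      ... | inj₂ refl = ⊥-elim (q∤b (∣-trans j∣i i∣b))

φ-*prime : ∀ D q → Prime q → Coprime D q → φ (D * q) + φ D ≡ q * φ D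
φ-*prime D q q-prime D⊥q = begin
    φ (D * q) + φ D
  ≡⟨ cong₂ _+_ (trans (count-ext (D * q) _ _ (λ b _ → coprimeTo-*prime D q q-prime b))
                      (cong (count (λ b → cD b ∧ not (q∣ b))) (*-comm D q)))
               (sym (count-multiples D q cD D⊥q (coprimeTo-periodic D))) ⟩
    count (λ b → cD b ∧ not (q∣ b)) (q * D) + count (λ b → cD b ∧ q∣ b) (q * D)
  ≡⟨ +-comm (count (λ b → cD b ∧ not (q∣ b)) (q * D)) _ ⟩
    count (λ b → cD b ∧ q∣ b) (q * D) + count (λ b → cD b ∧ not (q∣ b)) (q * D)
  ≡⟨ sym (count-split (q * D) cD q∣_) ⟩
    count cD (q * D)
  ≡⟨ count-coprimeTo q D ⟩
    q * φ D ∎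
  where
  open ≡-Reasoning
  instance
    q≢0 : NonZero q
    q≢0 = prime⇒nonZero q-prime
  cD : ℕ → Bool
  cD = coprimeTo D
  q∣_ : ℕ → Bool
  q∣ b = ⌊ q ∣? b ⌋

φᶜ-*prime : ∀ D q → Prime q → Coprime D q → φᶜ (D * q) ≡ q * φᶜ D + φ D
φᶜ-*prime D q q-prime D⊥q = +-cancelˡ-≡ (φ (D * q)) _ _ (begin
    φ (D * q) + φᶜ (D * q)           ≡⟨ φ+φᶜ (D * q) ⟩
    D * q                            ≡⟨ cong (_* q) (sym (φ+φᶜ D)) ⟩
    (φ D + φᶜ D) * q                 ≡⟨ rearrange (φ D) (φᶜ D) q ⟩
    q * φ D + q * φᶜ D               ≡⟨ cong (_+ q * φᶜ D) (sym (φ-*prime D q q-prime D⊥q)) ⟩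
    (φ (D * q) + φ D) + q * φᶜ D     ≡⟨ rearrange′ (φ (D * q)) (φ D) (q * φᶜ D) ⟩
    φ (D * q) + (q * φᶜ D + φ D) ∎)
  where
  open ≡-Reasoning
  rearrange : ∀ F H q → (F + H) * q ≡ q * F + q * H
  rearrange = solve-∀
  rearrange′ : ∀ x y z → (x + y) + z ≡ x + (z + y)
  rearrange′ = solve-∀

-- The arithmetic core, in terms of a = q ∸ 1 and b = P ∸ 1.  With F = φ D and H = φᶜ D the degree
-- formula gives
--   deg(q·P·E) + 1 = q·P·E·F + H,
--   deg(P·E) + 1   = P·E·(aF) + (qH + F),
--   deg(E) + 1     = E·(b·aF) + (P·(qH + F) + aF).
-- Cancelling common terms, deg(E) ≤ deg(P·E) becomes qbH + (a + b)F ≤ a·EF, and deg(P·E) < deg(q·P·E)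
-- becomes aH + F < P·EF; the former implies the latter since a < P.
degree-inequality : ∀ a b E F H δ₀ δ₁ δ₂ → a ≤ b → 1 ≤ b → 1 ≤ E → 1 ≤ F →
  δ₀ + 1 ≡ suc a * (suc b * E) * F + H →
  δ₁ + 1 ≡ suc b * E * (a * F) + (suc a * H + F) →
  δ₂ + 1 ≡ E * (b * (a * F)) + (suc b * (suc a * H + F) + a * F) →
  δ₂ ≤ δ₁ → δ₁ < δ₀
degree-inequality a b E F H δ₀ δ₁ δ₂ a≤b 1≤b 1≤E 1≤F e₀ e₁ e₂ δ₂≤δ₁ =
  +-cancelʳ-< 1 δ₁ δ₀ (begin-strict
    δ₁ + 1                               ≡⟨ trans e₁ (δ₁-shape′ a b E F H) ⟩
    C′ + (a * H + F)                     <⟨ +-monoʳ-< C′ aH+F<PEF ⟩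
    C′ + suc b * (E * F)                 ≡⟨ sym (trans e₀ (δ₀-shape a b E F H)) ⟩
    δ₀ + 1                               ∎)
  where
  open ≤-Reasoning
  instance
    b≢0 : NonZero b
    b≢0 = >-nonZero 1≤b
    a+b≢0 : NonZero (a + b)
    a+b≢0 = >-nonZero (≤-trans 1≤b (m≤n+m b a))
    EF≢0 : NonZero (E * F)
    EF≢0 = >-nonZero (*-mono-≤ 1≤E 1≤F)

  -- The terms shared by deg(E) + 1 and deg(P·E) + 1 (C), and by deg(P·E) + 1 and deg(q·P·E) + 1 (C′).
  C C′ : ℕ
  C  = E * (b * (a * F)) + (suc a * H + F)
  C′ = H + suc b * E * (a * F)

  δ₀-shape : ∀ a b E F H → suc a * (suc b * E) * F + H ≡ (H + suc b * E * (a * F)) + suc b * (E * F)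
  δ₀-shape = solve-∀
  δ₁-shape : ∀ a b E F H → suc b * E * (a * F) + (suc a * H + F)
                          ≡ (E * (b * (a * F)) + (suc a * H + F)) + a * (E * F)
  δ₁-shape = solve-∀
  δ₁-shape′ : ∀ a b E F H → suc b * E * (a * F) + (suc a * H + F) ≡ (H + suc b * E * (a * F)) + (a * H + F)
  δ₁-shape′ = solve-∀
  δ₂-shape : ∀ a b E F H → E * (b * (a * F)) + (suc b * (suc a * H + F) + a * F)
                          ≡ (E * (b * (a * F)) + (suc a * H + F)) + (suc a * b * H + (a + b) * F)
  δ₂-shape = solve-∀

  hypothesis : suc a * b * H + (a + b) * F ≤ a * (E * F)
  hypothesis = +-cancelˡ-≤ C _ _ (begin
    C + (suc a * b * H + (a + b) * F)    ≡⟨ sym (trans e₂ (δ₂-shape a b E F H)) ⟩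
    δ₂ + 1                               ≤⟨ +-monoˡ-≤ 1 δ₂≤δ₁ ⟩
    δ₁ + 1                               ≡⟨ trans e₁ (δ₁-shape a b E F H) ⟩
    C + a * (E * F)                      ∎)

  aH+F<PEF : a * H + F < suc b * (E * F)
  aH+F<PEF = begin-strict
    a * H + F                            ≤⟨ +-mono-≤ (*-monoˡ-≤ H (≤-trans (n≤1+n a) (m≤m*n (suc a) b)))
                                                     (m≤n*m F (a + b)) ⟩
    suc a * b * H + (a + b) * F          ≤⟨ hypothesis ⟩
    a * (E * F)                          <⟨ *-monoˡ-< (E * F) (s≤s a≤b) ⟩
    suc b * (E * F)                      ∎

degree-comparison : ∀ q P E F F₁ F₂ H H₁ H₂ δ₀ δ₁ δ₂ → 2 ≤ q → q < P → 1 ≤ E → 1 ≤ F →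
  F₁ + F ≡ q * F → F₂ + F₁ ≡ P * F₁ → H₁ ≡ q * H + F → H₂ ≡ P * H₁ + F₁ →
  δ₀ + 1 ≡ q * (P * E) * F + H → δ₁ + 1 ≡ P * E * F₁ + H₁ → δ₂ + 1 ≡ E * F₂ + H₂ →
  δ₂ ≤ δ₁ → δ₁ < δ₀
degree-comparison (suc a) (suc b) E F F₁ F₂ H H₁ H₂ δ₀ δ₁ δ₂ (s≤s 1≤a) (s≤s a<b) 1≤E 1≤F
                  φ₁ φ₂ φᶜ₁ φᶜ₂ e₀ e₁ e₂ δ₂≤δ₁ =
  degree-inequality a b E F H δ₀ δ₁ δ₂ (<⇒≤ a<b) (≤-trans 1≤a (<⇒≤ a<b)) 1≤E 1≤F e₀
    (trans e₁ (cong₂ (λ x y → suc b * E * x + y) F₁≡aF φᶜ₁))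
    (trans e₂ (cong₂ (λ x y → E * x + y) F₂≡baF
                     (trans φᶜ₂ (cong₂ (λ x y → suc b * x + y) φᶜ₁ F₁≡aF))))
    δ₂≤δ₁
  where
  predecessor-multiple : ∀ {x} c y → x + y ≡ suc c * y → x ≡ c * y
  predecessor-multiple c y eq = +-cancelʳ-≡ y _ _ (trans eq (+-comm y (c * y)))
  F₁≡aF : F₁ ≡ a * F
  F₁≡aF = predecessor-multiple a F φ₁
  F₂≡baF : F₂ ≡ b * (a * F)
  F₂≡baF = trans (predecessor-multiple b F₁ φ₂) (cong (b *_) F₁≡aF)

prodFrom-split : ∀ (p : ℕ → ℕ) i a b → prodFrom p i (a + b) ≡ prodFrom p i a * prodFrom p (i + a) b
prodFrom-split p i zero    b = trans (cong (λ j → prodFrom p j b) (sym (+-identityʳ i))) (sym (+-identityʳ _))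
prodFrom-split p i (suc a) b = begin
    p i * prodFrom p (suc i) (a + b)
  ≡⟨ cong (p i *_) (prodFrom-split p (suc i) a b) ⟩
    p i * (prodFrom p (suc i) a * prodFrom p (suc i + a) b)
  ≡⟨ sym (*-assoc (p i) _ _) ⟩
    p i * prodFrom p (suc i) a * prodFrom p (suc i + a) b
  ≡⟨ cong (λ j → p i * prodFrom p (suc i) a * prodFrom p j b) (sym (+-suc i a)) ⟩
    p i * prodFrom p (suc i) a * prodFrom p (i + suc a) b ∎
  where open ≡-Reasoning

prodFrom-closed : ∀ (Q : ℕ → Set) → Q 1 → (∀ x y → Q x → Q y → Q (x * y)) →
  ∀ (p : ℕ → ℕ) i a → (∀ j → i ≤ j → j < i + a → Q (p j)) → Q (prodFrom p i a)
prodFrom-closed Q Q1 Q* p i zero    Qp = Q1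
prodFrom-closed Q Q1 Q* p i (suc a) Qp = Q* _ _ (Qp i ≤-refl (m<m+n i (s≤s z≤n)))
  (prodFrom-closed Q Q1 Q* p (suc i) a (λ j i<j j<i+1+a → Qp j (<⇒≤ i<j) (subst (j <_) (sym (+-suc i a)) j<i+1+a)))

coprime-* : ∀ {x y X} → Coprime x X → Coprime y X → Coprime (x * y) X
coprime-* {x} x⊥X y⊥X {i} (i∣xy , i∣X) = y⊥X (coprime-divisor i⊥x i∣xy , i∣X)
  where
  i⊥x : Coprime i x
  i⊥x (j∣i , j∣x) = x⊥X (j∣x , ∣-trans j∣i i∣X)

-- The setting of the theorem: primes p₁ < p₂ < ⋯ < p_r, n = p₁⋯p_r.  At level k ≤ r the modulus
-- splits into the coprime factors Π k = p₁⋯p_k and V k = p_{k+1}⋯p_r, the vertex in question.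
module IncreasingPrimes (r : ℕ) (p : ℕ → ℕ)
  (prime : ∀ i → 1 ≤ i → i ≤ r → Prime (p i))
  (increasing : ∀ i → 1 ≤ i → i < r → p i < p (suc i)) where

  strictly-increasing : ∀ i j → 1 ≤ i → i < j → j ≤ r → p i < p j
  strictly-increasing i (suc j) 1≤i i<1+j 1+j≤r with m≤n⇒m<n∨m≡n (≤-pred i<1+j)
  ... | inj₂ refl = increasing i 1≤i 1+j≤r
  ... | inj₁ i<j  = <-trans (strictly-increasing i j 1≤i i<j (<⇒≤ 1+j≤r))
                            (increasing j (≤-trans 1≤i (<⇒≤ i<j)) 1+j≤r)

  distinct-coprime : ∀ i j → 1 ≤ i → i < j → j ≤ r → Coprime (p i) (p j)
  distinct-coprime i j 1≤i i<j j≤r = Coprimality.sym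
    (prime⇒coprime (prime j (≤-trans 1≤i (<⇒≤ i<j)) j≤r)
                   {{prime⇒nonZero (prime i 1≤i (≤-trans (<⇒≤ i<j) j≤r))}}
                   (strictly-increasing i j 1≤i i<j j≤r))

  prime-pos : ∀ j → 1 ≤ j → j ≤ r → 1 ≤ p j
  prime-pos j 1≤j j≤r = <⇒≤ (nonTrivial⇒n>1 (p j) {{prime⇒nonTrivial (prime j 1≤j j≤r)}})

  Π : ℕ → ℕ
  Π k = prodFrom p 1 k

  V : ℕ → ℕ
  V k = prodRange p (suc k) r

  in-suffix : ∀ k j → k ≤ r → j < suc k + (r ∸ k) → j ≤ r
  in-suffix k j k≤r j< = ≤-pred (subst (j <_) (cong suc (m+[n∸m]≡n k≤r)) j<)

  n≡Π*V : ∀ k → k ≤ r → prodRange p 1 r ≡ Π k * V k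
  n≡Π*V k k≤r = trans (cong (prodFrom p 1) (sym (m+[n∸m]≡n k≤r))) (prodFrom-split p 1 k (r ∸ k))

  Π-step : ∀ k → Π (suc k) ≡ Π k * p (suc k)
  Π-step k = begin
      prodFrom p 1 (suc k)           ≡⟨ cong (prodFrom p 1) (+-comm 1 k) ⟩
      prodFrom p 1 (k + 1)           ≡⟨ prodFrom-split p 1 k 1 ⟩
      Π k * (p (suc k) * 1)          ≡⟨ cong (Π k *_) (*-identityʳ (p (suc k))) ⟩
      Π k * p (suc k) ∎
    where open ≡-Reasoning

  V-step : ∀ k → k < r → V k ≡ p (suc k) * V (suc k)
  V-step k k<r = cong (prodFrom p (suc k)) (+-∸-assoc 1 k<r)

  Π-pos : ∀ k → k ≤ r → 1 ≤ Π k
  Π-pos k k≤r = prodFrom-closed (1 ≤_) ≤-refl (λ _ _ → *-mono-≤) p 1 k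
    (λ j 1≤j j≤k → prime-pos j 1≤j (≤-trans (≤-pred j≤k) k≤r))

  V-pos : ∀ k → k ≤ r → 1 ≤ V k
  V-pos k k≤r = prodFrom-closed (1 ≤_) ≤-refl (λ _ _ → *-mono-≤) p (suc k) (r ∸ k)
    (λ j k<j j< → prime-pos j (≤-trans (s≤s z≤n) k<j) (in-suffix k j k≤r j<))

  coprime-prodFrom : ∀ X i a → (∀ j → i ≤ j → j < i + a → Coprime (p j) X) → Coprime (prodFrom p i a) X
  coprime-prodFrom X = prodFrom-closed (λ x → Coprime x X) (1-coprimeTo X) (λ _ _ → coprime-*) p

  Π⊥V : ∀ k → k ≤ r → Coprime (Π k) (V k)
  Π⊥V k k≤r = coprime-prodFrom (V k) 1 k λ i 1≤i i≤k →
    Coprimality.sym (coprime-prodFrom (p i) (suc k) (r ∸ k) λ j k<j j< →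
      Coprimality.sym (distinct-coprime i j 1≤i (<-≤-trans i≤k k<j) (in-suffix k j k≤r j<)))

  Π⊥p : ∀ k → k < r → Coprime (Π k) (p (suc k))
  Π⊥p k k<r = coprime-prodFrom (p (suc k)) 1 k λ i 1≤i i≤k → distinct-coprime i (suc k) 1≤i i≤k k<r

  deg-level : ∀ k → k ≤ r → deg (prodRange p 1 r) (V k) + 1 ≡ V k * φ (Π k) + φᶜ (Π k)
  deg-level k k≤r = trans (cong (λ n → deg n (V k) + 1) (n≡Π*V k k≤r))
                          (deg-formula (Π k) (V k) (Π-pos k k≤r) (V-pos k k≤r) (Π⊥V k k≤r))

  φ-level : ∀ k → k < r → φ (Π (suc k)) + φ (Π k) ≡ p (suc k) * φ (Π k)
  φ-level k k<r = subst (λ m → φ m + φ (Π k) ≡ p (suc k) * φ (Π k)) (sym (Π-step k))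
    (φ-*prime (Π k) (p (suc k)) (prime (suc k) (s≤s z≤n) k<r) (Π⊥p k k<r))

  φᶜ-level : ∀ k → k < r → φᶜ (Π (suc k)) ≡ p (suc k) * φᶜ (Π k) + φ (Π k)
  φᶜ-level k k<r = subst (λ m → φᶜ m ≡ p (suc k) * φᶜ (Π k) + φ (Π k)) (sym (Π-step k))
    (φᶜ-*prime (Π k) (p (suc k)) (prime (suc k) (s≤s z≤n) k<r) (Π⊥p k k<r))

-- With s = t + 3 the vertices are V t = q·P·E, V (t+1) = P·E and V (t+2) = E, where q = p_{t+1},
-- P = p_{t+2}; the degree formula at levels t, t+1, t+2 and the totient recurrences feed
-- degree-comparison.
lemma3p3 : (r : ℕ) (p : ℕ → ℕ) →
    r ≥ 3 →
    (∀ i → 1 ≤ i → i ≤ r → Prime (p i)) →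
    (∀ i → 1 ≤ i → i < r → p i < p (suc i)) →
    (s : ℕ) → 3 ≤ s → s ≤ r →
    deg (prodRange p 1 r) (prodRange p (s ∸ 1) r) ≥ deg (prodRange p 1 r) (prodRange p s r) →
    deg (prodRange p 1 r) (prodRange p (s ∸ 2) r) > deg (prodRange p 1 r) (prodRange p (s ∸ 1) r)
lemma3p3 r p _ prime increasing (suc (suc (suc t))) (s≤s (s≤s (s≤s _))) 3+t≤r deg-hypothesis =
  degree-comparison (p (1 + t)) (p (2 + t)) (V (2 + t)) (φ (Π t)) (φ (Π (1 + t))) (φ (Π (2 + t)))
                    (φᶜ (Π t)) (φᶜ (Π (1 + t))) (φᶜ (Π (2 + t))) _ _ _
    (nonTrivial⇒n>1 _ {{prime⇒nonTrivial (prime (1 + t) (s≤s z≤n) 1+t≤r)}})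
    (increasing (1 + t) (s≤s z≤n) 2+t≤r)
    (V-pos (2 + t) 2+t≤r) (φ-pos (Π t) (Π-pos t t≤r))
    (φ-level t 1+t≤r) (φ-level (1 + t) 2+t≤r) (φᶜ-level t 1+t≤r) (φᶜ-level (1 + t) 2+t≤r)
    (trans (deg-level t t≤r) (cong (λ v → v * φ (Π t) + φᶜ (Π t)) V[t]≡qPE))
    (trans (deg-level (1 + t) 1+t≤r)
           (cong (λ v → v * φ (Π (1 + t)) + φᶜ (Π (1 + t))) (V-step (1 + t) 2+t≤r)))
    (deg-level (2 + t) 2+t≤r)
    deg-hypothesis
  where
  open IncreasingPrimes r p prime increasing
  2+t≤r : 2 + t ≤ r
  2+t≤r = <⇒≤ 3+t≤r
  1+t≤r : 1 + t ≤ r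
  1+t≤r = <⇒≤ 2+t≤r
  t≤r : t ≤ r
  t≤r = <⇒≤ 1+t≤r
  V[t]≡qPE : V t ≡ p (1 + t) * (p (2 + t) * V (2 + t))
  V[t]≡qPE = trans (V-step t 1+t≤r) (cong (p (1 + t) *_) (V-step (1 + t) 2+t≤r))
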